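{- For $n=0,1,2,\ldots$, $$\sum_{k=0}^{[n/2]}\binom{n}{2k}2^{2k}E_{2n-2k}=(-1)^n.$$
   Context: The Euler numbers $E_n$ are defined by $\frac{2e^t}{e^{2t}+1}=\sum_{n=0}^\infty E_n\frac{t^n}{n!}$ for $|t|<\pi/2$. $[x]$ denotes the greatest integer not exceeding $x$. -}

module Defs where

open import Data.Nat as ℕ using (ℕ; zero; suc; _∸_)
open import Data.Nat.Combinatorics using (_C_)
open import Data.Integer as ℤ using (ℤ; +_; -_; _*_; _+_)
open import Data.Fin using (Fin; toℕ; fromℕ)
open import Data.Vec using (Vec; []; _∷_; lookup; tabulate; _∷ʳ_)
open import Data.Bool using (Bool; true; false; if_then_else_)

-- coefficient of t^k/k! in cosh t: 1 if k even, 0 if k odd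
coshCoeff : ℕ → ℤ
coshCoeff zero = + 1
coshCoeff (suc zero) = + 0
coshCoeff (suc (suc k)) = coshCoeff k

sumTo : ℕ → (ℕ → ℤ) → ℤ
sumTo zero f = f 0
sumTo (suc n) f = sumTo n f + f (suc n)

-- Σ_{k=0}^{m} f k  with m < bound of the table; helper on Fin-indexed tables
-- Euler numbers via cosh(t) · sech(t) = 1, i.e.
--   E_0 = 1,  and for n ≥ 1:  Σ_{k=0}^{n} C(n,k) c_k E_{n-k} = 0  (c_k = cosh coeff, c_0 = 1)
-- so E_n = - Σ_{k=1}^{n} C(n,k) c_k E_{n-k}.
-- eulerTable n = (E_0, …, E_n)
eulerTable : (n : ℕ) → Vec ℤ (suc n)
eulerTable zero = + 1 ∷ []
eulerTable (suc n) = prev ∷ʳ new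
  where
  prev : Vec ℤ (suc n)
  prev = eulerTable n
  -- E_j for j ≤ n (out-of-range indices unused)
  get : ℕ → ℤ
  get j = lookup prev (Data.Fin.fromℕ< {j ℕ.⊓ n} (ℕ.s≤s (Data.Nat.Properties.m⊓n≤n j n)))
    where import Data.Fin; import Data.Nat.Properties
  new : ℤ
  new = - sumTo n (λ i → (+ (suc n C suc i)) * (coshCoeff (suc i) * get (n ∸ i)))

E : ℕ → ℤ
E n = lookup (eulerTable n) (fromℕ n)

module Submission where

-- Proof idea: umbral calculus with shift operators.  Let S be the shift
-- f ↦ f ∘ suc on integer sequences and read polynomials in S as operators.
-- The recurrence defining the Euler numbers (cosh t · sech t = 1) says
--     ((S + 1)^m E)(0) + ((S - 1)^m E)(0) = 2 δ_m        for every m.   (★)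
-- For c = ±1 we have S (S + 2c) = (S + c)² - 1, so applying (S(S + 2c))^n
-- to E and evaluating at 0 only sees the values ((S + c)^(2k) E)(0);
-- adding the cases c = 1 and c = -1 and using (★) gives 2 (-1)^n.  On the
-- other hand (S(S + 2c))^n = S^n (S + 2c)^n expands binomially, and the sum
-- of the two expansions is Σ_i C(n,i) (2^i + (-2)^i) E_(2n-i), in which the
-- odd i cancel and the even i = 2k contribute 2 · 4^k.  Dividing by 2 gives
-- the corollary.

module EulerSums where

  open import Defs
  open import Data.Nat as ℕ using (ℕ; zero; suc; _∸_; _≤_; _<_; z≤n; s≤s)
  import Data.Nat.Properties as ℕₚ
  open import Data.Nat.DivMod using (_/_; m/n≡1+[m∸n]/n)
  open import Data.Nat.Combinatorics using (_C_; nCk+nC[k+1]≡[n+1]C[k+1]; nCk≡nC[n∸k])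
  open import Data.Nat.Combinatorics.Specification using (k>n⇒nCk≡0)
  open import Data.Integer using (ℤ; +_; -_; _+_; _-_; _*_; _^_; 0ℤ; 1ℤ; -1ℤ)
  import Data.Integer.Properties as ℤₚ
  open import Data.Integer.Tactic.RingSolver using (solve-∀)
  open import Data.Fin using (fromℕ; fromℕ<)
  open import Data.Fin.Properties using (fromℕ-def)
  open import Data.Vec using (Vec; []; _∷_; lookup; _∷ʳ_)
  open import Relation.Nullary using (yes; no)
  open import Relation.Binary.PropositionalEquality
  open ≡-Reasoning

  sumTo-cong : ∀ n {f g : ℕ → ℤ} → (∀ j → j ≤ n → f j ≡ g j) → sumTo n f ≡ sumTo n g
  sumTo-cong zero    f≡g = f≡g 0 z≤n
  sumTo-cong (suc n) f≡g =
    cong₂ _+_ (sumTo-cong n (λ j j≤n → f≡g j (ℕₚ.m≤n⇒m≤1+n j≤n))) (f≡g (suc n) ℕₚ.≤-refl)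

  sumTo-+ : ∀ n (f g : ℕ → ℤ) → sumTo n f + sumTo n g ≡ sumTo n (λ j → f j + g j)
  sumTo-+ zero    f g = refl
  sumTo-+ (suc n) f g = begin
    (sumTo n f + f (suc n)) + (sumTo n g + g (suc n))
      ≡⟨ interchange (sumTo n f) (f (suc n)) (sumTo n g) (g (suc n)) ⟩
    (sumTo n f + sumTo n g) + (f (suc n) + g (suc n))
      ≡⟨ cong (_+ (f (suc n) + g (suc n))) (sumTo-+ n f g) ⟩
    sumTo n (λ j → f j + g j) + (f (suc n) + g (suc n)) ∎
    where
    interchange : ∀ a b c d → (a + b) + (c + d) ≡ (a + c) + (b + d)
    interchange = solve-∀

  sumTo-*ˡ : ∀ n a (f : ℕ → ℤ) → sumTo n (λ j → a * f j) ≡ a * sumTo n f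
  sumTo-*ˡ zero    a f = refl
  sumTo-*ˡ (suc n) a f =
    trans (cong (_+ a * f (suc n)) (sumTo-*ˡ n a f)) (sym (ℤₚ.*-distribˡ-+ a (sumTo n f) (f (suc n))))

  sumTo-head : ∀ n (f : ℕ → ℤ) → sumTo (suc n) f ≡ f 0 + sumTo n (λ j → f (suc j))
  sumTo-head zero    f = refl
  sumTo-head (suc n) f = trans (cong (_+ f (suc (suc n))) (sumTo-head n f)) (ℤₚ.+-assoc (f 0) _ _)

  sumTo-reverse : ∀ n (f : ℕ → ℤ) → sumTo n f ≡ sumTo n (λ i → f (n ∸ i))
  sumTo-reverse zero    f = refl
  sumTo-reverse (suc n) f = begin
    sumTo n f + f (suc n)                 ≡⟨ cong (_+ f (suc n)) (sumTo-reverse n f) ⟩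
    sumTo n (λ i → f (n ∸ i)) + f (suc n) ≡⟨ ℤₚ.+-comm (sumTo n (λ i → f (n ∸ i))) (f (suc n)) ⟩
    f (suc n) + sumTo n (λ i → f (n ∸ i)) ≡⟨ sym (sumTo-head n (λ i → f (suc n ∸ i))) ⟩
    sumTo (suc n) (λ i → f (suc n ∸ i))   ∎

  -- Reversing a binomial sum; by C(n,j) = C(n,n-j) the coefficient keeps its shape.
  binomial-reverse : ∀ n (g : ℕ → ℕ → ℤ) →
    sumTo n (λ j → + (n C j) * g (n ∸ j) j) ≡ sumTo n (λ i → + (n C i) * g i (n ∸ i))
  binomial-reverse n g = trans (sumTo-reverse n _) (sumTo-cong n λ i i≤n →
    cong₂ (λ k l → + k * g l (n ∸ i)) (sym (nCk≡nC[n∸k] i≤n)) (ℕₚ.m∸[m∸n]≡n i≤n))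

  sumTo-pascal : ∀ m (x : ℕ → ℤ) →
    sumTo (suc m) (λ j → + (suc m C j) * x j) ≡
    sumTo m (λ j → + (m C j) * x (suc j)) + sumTo m (λ j → + (m C j) * x j)
  sumTo-pascal m x = begin
    sumTo (suc m) (λ j → + (suc m C j) * x j)
      ≡⟨ sumTo-head m _ ⟩
    x₀ + sumTo m (λ j → + (suc m C suc j) * x (suc j))
      ≡⟨ cong (_+_ x₀) (sumTo-cong m λ j _ → pascal j) ⟩
    x₀ + sumTo m (λ j → + (m C j) * x (suc j) + + (m C suc j) * x (suc j))
      ≡⟨ cong (_+_ x₀) (sym (sumTo-+ m _ _)) ⟩
    x₀ + (A + B)
      ≡⟨ rotate x₀ A B ⟩
    A + (x₀ + B)
      ≡⟨ cong (_+_ A) lower-sum ⟩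
    A + sumTo m (λ j → + (m C j) * x j) ∎
    where
    x₀ = 1ℤ * x 0
    A  = sumTo m (λ j → + (m C j) * x (suc j))
    B  = sumTo m (λ j → + (m C suc j) * x (suc j))

    rotate : ∀ a b c → a + (b + c) ≡ b + (a + c)
    rotate = solve-∀

    pascal : ∀ j → + (suc m C suc j) * x (suc j) ≡ + (m C j) * x (suc j) + + (m C suc j) * x (suc j)
    pascal j = begin
      + (suc m C suc j) * x (suc j)
        ≡⟨ cong (λ k → + k * x (suc j)) (sym (nCk+nC[k+1]≡[n+1]C[k+1] m j)) ⟩
      + (m C j ℕ.+ m C suc j) * x (suc j)
        ≡⟨ cong (_* x (suc j)) (ℤₚ.pos-+ (m C j) (m C suc j)) ⟩
      (+ (m C j) + + (m C suc j)) * x (suc j)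
        ≡⟨ ℤₚ.*-distribʳ-+ (x (suc j)) (+ (m C j)) (+ (m C suc j)) ⟩
      + (m C j) * x (suc j) + + (m C suc j) * x (suc j) ∎

    -- Σ_{j ≤ m} C(m,j) x_j, seen as a sum up to m + 1 whose top term C(m,m+1) x_(m+1) vanishes.
    lower-sum : x₀ + B ≡ sumTo m (λ j → + (m C j) * x j)
    lower-sum = begin
      x₀ + B
        ≡⟨ sym (sumTo-head m _) ⟩
      sumTo m (λ j → + (m C j) * x j) + + (m C suc m) * x (suc m)
        ≡⟨ cong (λ k → sumTo m (λ j → + (m C j) * x j) + + k * x (suc m)) (k>n⇒nCk≡0 (ℕₚ.n<1+n m)) ⟩
      sumTo m (λ j → + (m C j) * x j) + 0ℤ
        ≡⟨ ℤₚ.+-identityʳ _ ⟩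
      sumTo m (λ j → + (m C j) * x j) ∎

  sumTo-evens : ∀ n (G : ℕ → ℤ) → (∀ k → G (suc (2 ℕ.* k)) ≡ 0ℤ) →
    sumTo n G ≡ sumTo (n / 2) (λ k → G (2 ℕ.* k))
  sumTo-evens zero          G odd = refl
  sumTo-evens (suc zero)    G odd = trans (cong (_+_ (G 0)) (odd 0)) (ℤₚ.+-identityʳ (G 0))
  sumTo-evens (suc (suc n)) G odd = begin
    sumTo (suc (suc n)) G
      ≡⟨ trans (sumTo-head (suc n) G) (cong (_+_ (G 0)) (sumTo-head n _)) ⟩
    G 0 + (G 1 + sumTo n G₂)
      ≡⟨ cong (λ z → G 0 + (z + sumTo n G₂)) (odd 0) ⟩
    G 0 + (0ℤ + sumTo n G₂)
      ≡⟨ cong (_+_ (G 0)) (ℤₚ.+-identityˡ _) ⟩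
    G 0 + sumTo n G₂
      ≡⟨ cong (_+_ (G 0)) (sumTo-evens n G₂ odd₂) ⟩
    G 0 + sumTo (n / 2) (λ k → G₂ (2 ℕ.* k))
      ≡⟨ cong (_+_ (G 0)) (sumTo-cong (n / 2) λ k _ → cong G (sym (ℕₚ.*-suc 2 k))) ⟩
    G 0 + sumTo (n / 2) (λ k → G (2 ℕ.* suc k))
      ≡⟨ sym (sumTo-head (n / 2) _) ⟩
    sumTo (suc (n / 2)) (λ k → G (2 ℕ.* k))
      ≡⟨ cong (λ m → sumTo m (λ k → G (2 ℕ.* k))) (sym (m/n≡1+[m∸n]/n {suc (suc n)} {2} (s≤s (s≤s z≤n)))) ⟩
    sumTo (suc (suc n) / 2) (λ k → G (2 ℕ.* k)) ∎
    where
    G₂ : ℕ → ℤ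
    G₂ j = G (suc (suc j))
    odd₂ : ∀ k → G₂ (suc (2 ℕ.* k)) ≡ 0ℤ
    odd₂ k = trans (cong (λ m → G (suc m)) (sym (ℕₚ.*-suc 2 k))) (odd (suc k))

  sumTo-pair : ∀ n (a x y t e : ℕ → ℤ) → (∀ j → x j + y j ≡ + 2 * t j) →
    sumTo n (λ j → a j * (x j * e j)) + sumTo n (λ j → a j * (y j * e j)) ≡
    + 2 * sumTo n (λ j → a j * (t j * e j))
  sumTo-pair n a x y t e x+y≡2t = begin
    sumTo n (λ j → a j * (x j * e j)) + sumTo n (λ j → a j * (y j * e j))
      ≡⟨ sumTo-+ n _ _ ⟩
    sumTo n (λ j → a j * (x j * e j) + a j * (y j * e j))
      ≡⟨ sumTo-cong n (λ j _ → pair j) ⟩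
    sumTo n (λ j → + 2 * (a j * (t j * e j)))
      ≡⟨ sumTo-*ˡ n (+ 2) _ ⟩
    + 2 * sumTo n (λ j → a j * (t j * e j)) ∎
    where
    collect : ∀ a x y e → a * (x * e) + a * (y * e) ≡ a * ((x + y) * e)
    collect = solve-∀
    reassociate : ∀ a t e → a * ((+ 2 * t) * e) ≡ + 2 * (a * (t * e))
    reassociate = solve-∀
    pair : ∀ j → a j * (x j * e j) + a j * (y j * e j) ≡ + 2 * (a j * (t j * e j))
    pair j = begin
      a j * (x j * e j) + a j * (y j * e j) ≡⟨ collect (a j) (x j) (y j) (e j) ⟩
      a j * ((x j + y j) * e j)             ≡⟨ cong (λ s → a j * (s * e j)) (x+y≡2t j) ⟩
      a j * ((+ 2 * t j) * e j)             ≡⟨ reassociate (a j) (t j) (e j) ⟩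
      + 2 * (a j * (t j * e j))             ∎

  powers-of-±c : ∀ c i → c ^ i + (- c) ^ i ≡ + 2 * (coshCoeff i * c ^ i)
  powers-of-±c c zero          = refl
  powers-of-±c c (suc zero)    = cancel c
    where
    cancel : ∀ c → c * 1ℤ + (- c) * 1ℤ ≡ 0ℤ
    cancel = solve-∀
  powers-of-±c c (suc (suc i)) = begin
    c * (c * c ^ i) + (- c) * ((- c) * (- c) ^ i) ≡⟨ factor c (c ^ i) ((- c) ^ i) ⟩
    (c * c) * (c ^ i + (- c) ^ i)                 ≡⟨ cong ((c * c) *_) (powers-of-±c c i) ⟩
    (c * c) * (+ 2 * (coshCoeff i * c ^ i))       ≡⟨ regroup c (coshCoeff i) (c ^ i) ⟩
    + 2 * (coshCoeff i * (c * (c * c ^ i)))       ∎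
    where
    factor : ∀ c x y → c * (c * x) + (- c) * ((- c) * y) ≡ (c * c) * (x + y)
    factor = solve-∀
    regroup : ∀ c k x → (c * c) * (+ 2 * (k * x)) ≡ + 2 * (k * (c * (c * x)))
    regroup = solve-∀

  coshCoeff-even : ∀ k → coshCoeff (2 ℕ.* k) ≡ 1ℤ
  coshCoeff-even zero    = refl
  coshCoeff-even (suc k) = trans (cong coshCoeff (ℕₚ.*-suc 2 k)) (coshCoeff-even k)

  coshCoeff-odd : ∀ k → coshCoeff (suc (2 ℕ.* k)) ≡ 0ℤ
  coshCoeff-odd zero    = refl
  coshCoeff-odd (suc k) = trans (cong (λ m → coshCoeff (suc m)) (ℕₚ.*-suc 2 k)) (coshCoeff-odd k)

  pos-^ : ∀ m k → + (m ℕ.^ k) ≡ (+ m) ^ k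
  pos-^ m zero    = refl
  pos-^ m (suc k) = trans (ℤₚ.pos-* m (m ℕ.^ k)) (cong (+ m *_) (pos-^ m k))

  -- E (suc n) is the last entry of eulerTable (suc n) = eulerTable n ∷ʳ new, so
  -- the Euler recurrence follows from two facts about lookup in a snoc.
  lookup-∷ʳ-last : ∀ {A : Set} {n} (xs : Vec A n) x → lookup (xs ∷ʳ x) (fromℕ n) ≡ x
  lookup-∷ʳ-last []       x = refl
  lookup-∷ʳ-last (y ∷ xs) x = lookup-∷ʳ-last xs x

  lookup-∷ʳ-init : ∀ {A : Set} {n} (xs : Vec A n) x j (p : j < suc n) (q : j < n) →
    lookup (xs ∷ʳ x) (fromℕ< p) ≡ lookup xs (fromℕ< q)
  lookup-∷ʳ-init (y ∷ xs) x zero    p       q       = refl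
  lookup-∷ʳ-init (y ∷ xs) x (suc j) (s≤s p) (s≤s q) = lookup-∷ʳ-init xs x j p q

  eulerTable-lookup : ∀ n j (p : j < suc n) → lookup (eulerTable n) (fromℕ< p) ≡ E j
  eulerTable-lookup zero    zero    p = refl
  eulerTable-lookup zero    (suc j) (s≤s ())
  eulerTable-lookup (suc n) j       p with j ℕ.<? suc n
  ... | yes q = trans (lookup-∷ʳ-init (eulerTable n) _ j p q) (eulerTable-lookup n j q)
  ... | no  q with ℕₚ.≤-antisym (ℕ.s≤s⁻¹ p) (ℕₚ.≮⇒≥ q)
  ...   | refl = cong (lookup (eulerTable (suc n))) (sym (fromℕ-def (suc n)))

  E-suc : ∀ n → E (suc n) ≡ - sumTo n (λ i → + (suc n C suc i) * (coshCoeff (suc i) * E (n ∸ i)))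
  E-suc n = trans (lookup-∷ʳ-last (eulerTable n) _) (cong -_ (sumTo-cong n λ i _ →
    cong (λ e → + (suc n C suc i) * (coshCoeff (suc i) * e))
      (trans (eulerTable-lookup n _ (s≤s (ℕₚ.m⊓n≤n (n ∸ i) n))) (cong E (ℕₚ.m≤n⇒m⊓n≡m (ℕₚ.m∸n≤m n i))))))

  δ : ℕ → ℤ
  δ zero    = 1ℤ
  δ (suc _) = 0ℤ

  -- Coefficientwise form of cosh t · sech t = 1.
  euler-convolution : ∀ N → sumTo N (λ k → + (N C k) * (coshCoeff k * E (N ∸ k))) ≡ δ N
  euler-convolution zero    = refl
  euler-convolution (suc n) = begin
    sumTo (suc n) (λ k → + (suc n C k) * (coshCoeff k * E (suc n ∸ k)))
      ≡⟨ sumTo-head n _ ⟩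
    1ℤ * (1ℤ * E (suc n)) + rest
      ≡⟨ cong (_+ rest) (trans (ℤₚ.*-identityˡ _) (ℤₚ.*-identityˡ (E (suc n)))) ⟩
    E (suc n) + rest
      ≡⟨ cong (_+ rest) (E-suc n) ⟩
    - rest + rest
      ≡⟨ ℤₚ.+-inverseˡ rest ⟩
    0ℤ ∎
    where
    rest = sumTo n (λ i → + (suc n C suc i) * (coshCoeff (suc i) * E (n ∸ i)))

  Seq : Set
  Seq = ℕ → ℤ

  _≐_ : Seq → Seq → Set
  f ≐ g = ∀ i → f i ≡ g i

  Δ : ℤ → Seq → Seq
  Δ c f i = f (suc i) + c * f i

  Δ^ : ℤ → ℕ → Seq → Seq
  Δ^ c zero    f = f
  Δ^ c (suc m) f = Δ c (Δ^ c m f)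

  Δ-cong : ∀ c {f g} → f ≐ g → Δ c f ≐ Δ c g
  Δ-cong c f≐g i = cong₂ (λ u v → u + c * v) (f≐g (suc i)) (f≐g i)

  Δ^-cong : ∀ c m {f g} → f ≐ g → Δ^ c m f ≐ Δ^ c m g
  Δ^-cong c zero    f≐g = f≐g
  Δ^-cong c (suc m) f≐g = Δ-cong c (Δ^-cong c m f≐g)

  Δ^-Δ : ∀ c m h → Δ^ c m (Δ c h) ≐ Δ^ c (suc m) h
  Δ^-Δ c zero    h i = refl
  Δ^-Δ c (suc m) h   = Δ-cong c (Δ^-Δ c m h)

  Δ^-- : ∀ c m f g → Δ^ c m (λ i → f i - g i) ≐ (λ i → Δ^ c m f i - Δ^ c m g i)
  Δ^-- c zero    f g i = refl
  Δ^-- c (suc m) f g i = trans (Δ-cong c (Δ^-- c m f g) i)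
    (distribute c (Δ^ c m f (suc i)) (Δ^ c m g (suc i)) (Δ^ c m f i) (Δ^ c m g i))
    where
    distribute : ∀ c a b d e → (a - b) + c * (d - e) ≡ (a + c * d) - (b + c * e)
    distribute = solve-∀

  Δ^-binomial : ∀ c m f i → Δ^ c m f i ≡ sumTo m (λ j → + (m C j) * (c ^ (m ∸ j) * f (i ℕ.+ j)))
  Δ^-binomial c zero    f i =
    sym (trans (ℤₚ.*-identityˡ _) (trans (ℤₚ.*-identityˡ _) (cong f (ℕₚ.+-identityʳ i))))
  Δ^-binomial c (suc m) f i = begin
    Δ^ c m f (suc i) + c * Δ^ c m f i
      ≡⟨ cong₂ (λ u v → u + c * v) (Δ^-binomial c m f (suc i)) (Δ^-binomial c m f i) ⟩
    sumTo m (λ j → + (m C j) * (c ^ (m ∸ j) * f (suc i ℕ.+ j))) +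
      c * sumTo m (λ j → + (m C j) * (c ^ (m ∸ j) * f (i ℕ.+ j)))
      ≡⟨ cong₂ _+_ (sumTo-cong m λ j _ → shifted j)
                   (sym (trans (sumTo-cong m scaled) (sumTo-*ˡ m c _))) ⟩
    sumTo m (λ j → + (m C j) * x (suc j)) + sumTo m (λ j → + (m C j) * x j)
      ≡⟨ sym (sumTo-pascal m x) ⟩
    sumTo (suc m) (λ j → + (suc m C j) * x j) ∎
    where
    x : ℕ → ℤ
    x j = c ^ (suc m ∸ j) * f (i ℕ.+ j)

    shifted : ∀ j → + (m C j) * (c ^ (m ∸ j) * f (suc i ℕ.+ j)) ≡ + (m C j) * x (suc j)
    shifted j = cong (λ k → + (m C j) * (c ^ (m ∸ j) * f k)) (sym (ℕₚ.+-suc i j))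

    pull-out : ∀ a c p y → a * ((c * p) * y) ≡ c * (a * (p * y))
    pull-out = solve-∀

    scaled : ∀ j → j ≤ m → + (m C j) * x j ≡ c * (+ (m C j) * (c ^ (m ∸ j) * f (i ℕ.+ j)))
    scaled j j≤m = begin
      + (m C j) * (c ^ (suc m ∸ j) * f (i ℕ.+ j))
        ≡⟨ cong (λ e → + (m C j) * (c ^ e * f (i ℕ.+ j))) (ℕₚ.+-∸-assoc 1 j≤m) ⟩
      + (m C j) * ((c * c ^ (m ∸ j)) * f (i ℕ.+ j))
        ≡⟨ pull-out (+ (m C j)) c (c ^ (m ∸ j)) (f (i ℕ.+ j)) ⟩
      c * (+ (m C j) * (c ^ (m ∸ j) * f (i ℕ.+ j))) ∎

  euler-umbral : ∀ m → Δ^ 1ℤ m E 0 + Δ^ -1ℤ m E 0 ≡ + 2 * δ m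
  euler-umbral m = begin
    Δ^ 1ℤ m E 0 + Δ^ -1ℤ m E 0
      ≡⟨ cong₂ _+_ (Δ^-binomial 1ℤ m E 0) (Δ^-binomial -1ℤ m E 0) ⟩
    sumTo m (λ j → + (m C j) * (1ℤ ^ (m ∸ j) * E j)) + sumTo m (λ j → + (m C j) * (-1ℤ ^ (m ∸ j) * E j))
      ≡⟨ sumTo-pair m (λ j → + (m C j)) (λ j → 1ℤ ^ (m ∸ j)) (λ j → -1ℤ ^ (m ∸ j))
                   (λ j → coshCoeff (m ∸ j)) E (λ j → cosh-parts (m ∸ j)) ⟩
    + 2 * sumTo m (λ j → + (m C j) * (coshCoeff (m ∸ j) * E j))
      ≡⟨ cong (+ 2 *_) (binomial-reverse m (λ k l → coshCoeff k * E l)) ⟩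
    + 2 * sumTo m (λ k → + (m C k) * (coshCoeff k * E (m ∸ k)))
      ≡⟨ cong (+ 2 *_) (euler-convolution m) ⟩
    + 2 * δ m ∎
    where
    cosh-parts : ∀ k → 1ℤ ^ k + -1ℤ ^ k ≡ + 2 * coshCoeff k
    cosh-parts k = begin
      1ℤ ^ k + -1ℤ ^ k                 ≡⟨ powers-of-±c 1ℤ k ⟩
      + 2 * (coshCoeff k * 1ℤ ^ k)     ≡⟨ cong (λ z → + 2 * (coshCoeff k * z)) (ℤₚ.^-zeroˡ k) ⟩
      + 2 * (coshCoeff k * 1ℤ)         ≡⟨ cong (+ 2 *_) (ℤₚ.*-identityʳ (coshCoeff k)) ⟩
      + 2 * coshCoeff k                ∎

  T : ℤ → Seq → Seq
  T c f i = Δ c f (suc i)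

  T^ : ℤ → ℕ → Seq → Seq
  T^ c zero    f = f
  T^ c (suc n) f = T c (T^ c n f)

  T^-shift : ∀ c n f i → T^ c n f i ≡ Δ^ c n f (n ℕ.+ i)
  T^-shift c zero    f i = refl
  T^-shift c (suc n) f i =
    trans (cong₂ (λ u v → u + c * v) (T^-shift c n f (suc (suc i))) (T^-shift c n f (suc i)))
          (cong₂ (λ u v → Δ^ c n f u + c * Δ^ c n f v)
                 (trans (ℕₚ.+-suc n (suc i)) (cong suc (ℕₚ.+-suc n i))) (ℕₚ.+-suc n i))

  T^-binomial : ∀ c n f → T^ c n f 0 ≡ sumTo n (λ i → + (n C i) * (c ^ i * f (2 ℕ.* n ∸ i)))
  T^-binomial c n f = begin
    T^ c n f 0
      ≡⟨ trans (T^-shift c n f 0) (Δ^-binomial c n f (n ℕ.+ 0)) ⟩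
    sumTo n (λ j → + (n C j) * (c ^ (n ∸ j) * f (n ℕ.+ 0 ℕ.+ j)))
      ≡⟨ binomial-reverse n (λ k l → c ^ k * f (n ℕ.+ 0 ℕ.+ l)) ⟩
    sumTo n (λ i → + (n C i) * (c ^ i * f (n ℕ.+ 0 ℕ.+ (n ∸ i))))
      ≡⟨ sumTo-cong n (λ i i≤n → cong (λ k → + (n C i) * (c ^ i * f k)) (index i≤n)) ⟩
    sumTo n (λ i → + (n C i) * (c ^ i * f (2 ℕ.* n ∸ i))) ∎
    where
    index : ∀ {i} → i ≤ n → n ℕ.+ 0 ℕ.+ (n ∸ i) ≡ 2 ℕ.* n ∸ i
    index {i} i≤n = begin
      n ℕ.+ 0 ℕ.+ (n ∸ i)   ≡⟨ cong (ℕ._+ (n ∸ i)) (ℕₚ.+-identityʳ n) ⟩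
      n ℕ.+ (n ∸ i)         ≡⟨ sym (ℕₚ.+-∸-assoc n i≤n) ⟩
      n ℕ.+ n ∸ i           ≡⟨ cong (λ k → n ℕ.+ k ∸ i) (sym (ℕₚ.+-identityʳ n)) ⟩
      2 ℕ.* n ∸ i           ∎

  -- The second difference in the exponent: Q h m = h (m+2) - h m.
  Q : Seq → Seq
  Q h m = h (suc (suc m)) - h m

  Q^ : ℕ → Seq → Seq
  Q^ zero    h = h
  Q^ (suc n) h = Q (Q^ n h)

  Q-cong : ∀ {a b} → a ≐ b → Q a ≐ Q b
  Q-cong a≐b m = cong₂ _-_ (a≐b (suc (suc m))) (a≐b m)

  Q^-cong : ∀ n {a b} → a ≐ b → Q^ n a ≐ Q^ n b
  Q^-cong zero    a≐b = a≐b
  Q^-cong (suc n) a≐b = Q-cong (Q^-cong n a≐b)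

  Q^-+ : ∀ n a b m → Q^ n a m + Q^ n b m ≡ Q^ n (λ k → a k + b k) m
  Q^-+ zero    a b m = refl
  Q^-+ (suc n) a b m =
    trans (regroup (Q^ n a (suc (suc m))) (Q^ n a m) (Q^ n b (suc (suc m))) (Q^ n b m))
          (Q-cong (Q^-+ n a b) m)
    where
    regroup : ∀ a b c d → (a - b) + (c - d) ≡ (a + c) - (b + d)
    regroup = solve-∀

  Q^-δ : ∀ n x m → Q^ n (λ k → x * δ k) m ≡ -1ℤ ^ n * (x * δ m)
  Q^-δ zero    x m = sym (ℤₚ.*-identityˡ _)
  Q^-δ (suc n) x m =
    trans (cong₂ _-_ (Q^-δ n x (suc (suc m))) (Q^-δ n x m)) (negate (-1ℤ ^ n) x (x * δ m))
    where
    negate : ∀ s x d → s * (x * 0ℤ) - s * d ≡ (-1ℤ * s) * d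
    negate = solve-∀

  T-square : ∀ c → c * c ≡ 1ℤ → ∀ g → T (c + c) g ≐ (λ i → Δ c (Δ c g) i - g i)
  T-square c c²≡1 g i = sym (begin
    Δ c (Δ c g) i - g i
      ≡⟨ expand c (g (suc (suc i))) (g (suc i)) (g i) ⟩
    (g (suc (suc i)) + (c + c) * g (suc i)) + (c * c - 1ℤ) * g i
      ≡⟨ cong (λ z → (g (suc (suc i)) + (c + c) * g (suc i)) + (z - 1ℤ) * g i) c²≡1 ⟩
    (g (suc (suc i)) + (c + c) * g (suc i)) + 0ℤ * g i
      ≡⟨ ℤₚ.+-identityʳ _ ⟩
    T (c + c) g i ∎)
    where
    expand : ∀ c a b d → (a + c * b) + c * (b + c * d) - d ≡ (a + (c + c) * b) + (c * c - 1ℤ) * d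
    expand = solve-∀

  Δ^-T : ∀ c → c * c ≡ 1ℤ → ∀ g m i → Δ^ c m (T (c + c) g) i ≡ Q (λ k → Δ^ c k g i) m
  Δ^-T c c²≡1 g m i = begin
    Δ^ c m (T (c + c) g) i
      ≡⟨ Δ^-cong c m (T-square c c²≡1 g) i ⟩
    Δ^ c m (λ j → Δ c (Δ c g) j - g j) i
      ≡⟨ Δ^-- c m (Δ c (Δ c g)) g i ⟩
    Δ^ c m (Δ c (Δ c g)) i - Δ^ c m g i
      ≡⟨ cong (_- Δ^ c m g i) (trans (Δ^-Δ c m (Δ c g) i) (Δ-cong c (Δ^-Δ c m g) i)) ⟩
    Q (λ k → Δ^ c k g i) m ∎

  Δ^-T^ : ∀ c → c * c ≡ 1ℤ → ∀ n f m i → Δ^ c m (T^ (c + c) n f) i ≡ Q^ n (λ k → Δ^ c k f i) m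
  Δ^-T^ c c²≡1 zero    f m i = refl
  Δ^-T^ c c²≡1 (suc n) f m i =
    trans (Δ^-T c c²≡1 (T^ (c + c) n f) m i) (Q-cong (λ k → Δ^-T^ c c²≡1 n f k i) m)

  two-sided-value : ∀ n → T^ (+ 2) n E 0 + T^ (- + 2) n E 0 ≡ -1ℤ ^ n * + 2
  two-sided-value n = begin
    T^ (+ 2) n E 0 + T^ (- + 2) n E 0
      ≡⟨ cong₂ _+_ (Δ^-T^ 1ℤ refl n E 0 0) (Δ^-T^ -1ℤ refl n E 0 0) ⟩
    Q^ n (λ k → Δ^ 1ℤ k E 0) 0 + Q^ n (λ k → Δ^ -1ℤ k E 0) 0
      ≡⟨ Q^-+ n _ _ 0 ⟩
    Q^ n (λ k → Δ^ 1ℤ k E 0 + Δ^ -1ℤ k E 0) 0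
      ≡⟨ Q^-cong n euler-umbral 0 ⟩
    Q^ n (λ k → + 2 * δ k) 0
      ≡⟨ Q^-δ n (+ 2) 0 ⟩
    -1ℤ ^ n * + 2 ∎

  two-sided-expansion : ∀ n → T^ (+ 2) n E 0 + T^ (- + 2) n E 0 ≡
    + 2 * sumTo (n / 2) (λ k → + (n C (2 ℕ.* k)) * (+ (2 ℕ.^ (2 ℕ.* k)) * E (2 ℕ.* n ∸ 2 ℕ.* k)))
  two-sided-expansion n = begin
    T^ (+ 2) n E 0 + T^ (- + 2) n E 0
      ≡⟨ cong₂ _+_ (T^-binomial (+ 2) n E) (T^-binomial (- + 2) n E) ⟩
    sumTo n (λ i → + (n C i) * ((+ 2) ^ i * E (2 ℕ.* n ∸ i))) +
      sumTo n (λ i → + (n C i) * ((- + 2) ^ i * E (2 ℕ.* n ∸ i)))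
      ≡⟨ sumTo-pair n (λ i → + (n C i)) ((+ 2) ^_) ((- + 2) ^_) (λ i → coshCoeff i * (+ 2) ^ i)
                   (λ i → E (2 ℕ.* n ∸ i)) (powers-of-±c (+ 2)) ⟩
    + 2 * sumTo n G
      ≡⟨ cong (+ 2 *_) (sumTo-evens n G odd-terms) ⟩
    + 2 * sumTo (n / 2) (λ k → G (2 ℕ.* k))
      ≡⟨ cong (+ 2 *_) (sumTo-cong (n / 2) λ k _ → even-term k) ⟩
    + 2 * sumTo (n / 2) (λ k → + (n C (2 ℕ.* k)) * (+ (2 ℕ.^ (2 ℕ.* k)) * E (2 ℕ.* n ∸ 2 ℕ.* k))) ∎
    where
    G : ℕ → ℤ
    G i = + (n C i) * ((coshCoeff i * (+ 2) ^ i) * E (2 ℕ.* n ∸ i))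

    odd-terms : ∀ k → G (suc (2 ℕ.* k)) ≡ 0ℤ
    odd-terms k = trans
      (cong (λ z → + (n C suc (2 ℕ.* k)) * ((z * (+ 2) ^ suc (2 ℕ.* k)) * E (2 ℕ.* n ∸ suc (2 ℕ.* k))))
            (coshCoeff-odd k))
      (ℤₚ.*-zeroʳ (+ (n C suc (2 ℕ.* k))))

    even-term : ∀ k → G (2 ℕ.* k) ≡ + (n C (2 ℕ.* k)) * (+ (2 ℕ.^ (2 ℕ.* k)) * E (2 ℕ.* n ∸ 2 ℕ.* k))
    even-term k = cong (λ z → + (n C (2 ℕ.* k)) * (z * E (2 ℕ.* n ∸ 2 ℕ.* k)))
      (trans (cong (_* (+ 2) ^ (2 ℕ.* k)) (coshCoeff-even k))
             (trans (ℤₚ.*-identityˡ _) (sym (pos-^ 2 (2 ℕ.* k)))))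

open EulerSums using (two-sided-value; two-sided-expansion)
open import Data.Integer.Properties using (*-cancelˡ-≡; *-comm)

open import Defs
open import Data.Nat using (ℕ; _*_; _∸_; _/_; _^_)
open import Data.Nat.Combinatorics using (_C_)
open import Data.Integer using (ℤ; +_; -1ℤ) renaming (_*_ to _*ℤ_; _^_ to _^ℤ_)
open import Relation.Binary.PropositionalEquality using (_≡_; sym; trans)

corollary2p2 : (n : ℕ) → sumTo (n / 2) (λ k → + (n C (2 * k)) *ℤ (+ (2 ^ (2 * k)) *ℤ E (2 * n ∸ 2 * k))) ≡ -1ℤ ^ℤ n
corollary2p2 n = *-cancelˡ-≡ (+ 2) _ _
  (trans (sym (two-sided-expansion n)) (trans (two-sided-value n) (*-comm (-1ℤ ^ℤ n) (+ 2))))
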